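{- Let $r\ge 2$ be an integer, let $\mathcal{H}$ be a $\mathrm{T}_{r}$-free $r$-graph with $\delta_{r-1}^{+}(\mathcal{H}) \ge r$, and let $e=\{u_1,\ldots,u_r\}\in\mathcal{H}$ be an edge. Then $N_{\mathcal{H}}(e\setminus\{u_i\}) \cap N_{\mathcal{H}}(u_i) = \emptyset$ for every $i\in[r]$. Moreover, the sets $N_{\mathcal{H}}(e\setminus\{u_i\})$, $i\in[r]$, are pairwise disjoint and each of them is independent in $\mathcal{H}$.
   Context: An $r$-graph $\mathcal{H}$ is a collection of $r$-subsets (edges) of a finite vertex set $V(\mathcal{H})$. $\mathrm{T}_{r} = \{\{1,\ldots,r-1,r\},\{1,\ldots,r-1,r+1\},\{r,r+1,\ldots,2r-1\}\}$; $\mathcal{H}$ is $\mathrm{T}_r$-free if it contains no copy of $\mathrm{T}_r$. The shadow $\partial\mathcal{H}$ is the set of $(r-1)$-subsets of $V(\mathcal{H})$ contained in some edge; for $f\in\partial\mathcal{H}$, $N_{\mathcal{H}}(f)=\{v\in V(\mathcal{H}) : f\cup\{v\}\in\mathcal{H}\}$, and $\delta_{r-1}^{+}(\mathcal{H}) = \min\{|N_{\mathcal{H}}(f)| : f\in\partial\mathcal{H}\}$. For a vertex $v$, $N_{\mathcal{H}}(v)=\{u\in V(\mathcal{H})\setminus\{v\} : \{u,v\}\subseteq E \text{ for some } E\in\mathcal{H}\}$. A set $I\subseteq V(\mathcal{H})$ is independent in $\mathcal{H}$ if every edge of $\mathcal{H}$ contains at most one vertex of $I$. -}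

module Defs where

open import Data.Nat using (ℕ; zero; suc; _∸_; _+_; _≤_; _<ᵇ_; _≡ᵇ_; _≤ᵇ_)
open import Data.Bool using (Bool; true; false; _∧_; _∨_; T)
open import Data.Fin using (Fin; toℕ; zero; suc)
import Data.Fin as F
open import Data.Fin.Subset using (Subset; _∈_; _⊆_; _∪_; _-_; ⁅_⁆; ∣_∣)
open import Data.Vec using (tabulate)
open import Data.Product using (Σ; ∃; _×_)
open import Relation.Nullary using (¬_; does)
open import Relation.Binary.PropositionalEquality using (_≡_; _≢_)
open import Function.Definitions using (Injective)

-- An r-graph on the vertex set Fin n is given by its edge indicator
-- H : Subset n → Bool (a collection of subsets of Fin n),
-- together with the requirement (Uniform) that every edge has exactly r vertices.
Hypergraph : ℕ → Set
Hypergraph n = Subset n → Bool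

IsEdge : ∀ {n} → Hypergraph n → Subset n → Set
IsEdge H E = T (H E)

Uniform : ∀ {n} → ℕ → Hypergraph n → Set
Uniform r H = ∀ E → IsEdge H E → ∣ E ∣ ≡ r

InShadow : ∀ {n} → ℕ → Hypergraph n → Subset n → Set
InShadow r H f = ∣ f ∣ ≡ r ∸ 1 × ∃ λ E → IsEdge H E × f ⊆ E

nbrSet : ∀ {n} → Hypergraph n → Subset n → Subset n
nbrSet H f = tabulate (λ v → H (f ∪ ⁅ v ⁆))

MinPosCodegreeAtLeast : ∀ {n} → ℕ → Hypergraph n → ℕ → Set
MinPosCodegreeAtLeast r H k = ∀ f → InShadow r H f → k ≤ ∣ nbrSet H f ∣

VNbr : ∀ {n} → Hypergraph n → Fin n → Fin n → Set
VNbr H v u = u ≢ v × ∃ λ E → IsEdge H E × u ∈ E × v ∈ E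

Independent : ∀ {n} → Hypergraph n → Subset n → Set
Independent H I = ∀ E → IsEdge H E → ∀ x y → x ∈ I → y ∈ I → x ∈ E → y ∈ E → x ≡ y

anyFin : ∀ {m} → (Fin m → Bool) → Bool
anyFin {zero} p = false
anyFin {suc m} p = p zero ∨ anyFin (λ i → p (suc i))

image : ∀ {m n} → (Fin m → Fin n) → Subset m → Subset n
image {m} φ S = tabulate (λ v → anyFin (λ i → i ∈ᵇ S ∧ does (φ i F.≟ v)))
  where
  _∈ᵇ_ : Fin m → Subset m → Bool
  i ∈ᵇ S = Data.Vec.lookup S i

-- T_r on vertex set Fin (2r-1) = {0,…,2r-2} (0-indexed relabelling of {1,…,2r-1}):
--   {1,…,r-1,r}     ↦ {i : i < r}
--   {1,…,r-1,r+1}   ↦ {i : i < r-1} ∪ {r}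
--   {r,r+1,…,2r-1}  ↦ {i : i ≥ r-1}
tVerts : ℕ → ℕ
tVerts r = r + r ∸ 1

tEdge₁ tEdge₂ tEdge₃ : (r : ℕ) → Subset (tVerts r)
tEdge₁ r = tabulate (λ i → toℕ i <ᵇ r)
tEdge₂ r = tabulate (λ i → (toℕ i <ᵇ (r ∸ 1)) ∨ (toℕ i ≡ᵇ r))
tEdge₃ r = tabulate (λ i → (r ∸ 1) ≤ᵇ toℕ i)

CopyOfT : ∀ {n} → ℕ → Hypergraph n → Set
CopyOfT r H = Σ (Fin (tVerts r) → F.Fin _) λ φ →
  Injective _≡_ _≡_ φ × IsEdge H (image φ (tEdge₁ r)) × IsEdge H (image φ (tEdge₂ r))
    × IsEdge H (image φ (tEdge₃ r))

TFree : ∀ {n} → ℕ → Hypergraph n → Set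
TFree r H = ¬ CopyOfT r H

-- Let u ∈ e ∈ H and w ∈ N(e - u) with w ≠ u. No edge E contains both u and w:
-- take such an E with ∣E ∩ (e - u)∣ least. If E meets e - u in some x, then E - x lies in the
-- shadow, so it has at least r neighbours, one of which, y, lies outside the (r-1)-set e - u;
-- then (E - x) ∪ {y} is an edge through u and w meeting e - u in fewer vertices. If E misses
-- e - u, then e = (e - u) ∪ {u}, (e - u) ∪ {w} and E form a copy of T_r.
-- Everything else follows: the edge (e - u′) ∪ {w} passes through u and w, and for
-- x ∈ N(e - u) the edge (e - u) ∪ {x} contains x in the role of u.
module Submission where

open import Defs
open import Data.Nat using (ℕ; zero; suc; _+_; _∸_; _<_; _≤_; s≤s)
import Data.Nat.Properties as ℕ
open import Data.Nat.Induction using (<-wellFounded)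
open import Data.Bool using (Bool; T)
open import Data.Bool.Properties using (T-≡; T-∨; T-∧)
open import Data.Fin using (Fin; zero; suc; toℕ; _≟_; _↑ˡ_; _↑ʳ_; splitAt; join)
import Data.Fin.Properties as Fin
open import Data.Fin.Subset hiding (⊥)
open import Data.Fin.Subset.Properties
open import Data.Vec using ([]; _∷_; tabulate; here; there)
open import Data.Vec.Properties using (lookup∘tabulate; []=⇒lookup; lookup⇒[]=)
import Data.Vec.Functional as Vector
open import Data.Product using (∃; _×_; _,_; proj₁; proj₂)
open import Data.Sum using (_⊎_; inj₁; inj₂; [_,_]′)
import Data.Sum as Sum
open import Data.Empty using (⊥; ⊥-elim)
open import Function using (_∘_)
open import Function.Bundles using (_⇔_; mk⇔; Equivalence)
open import Function.Definitions using (Injective)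
open import Induction.WellFounded using (Acc; acc)
open import Relation.Nullary using (yes; no; does; contradiction)
open import Relation.Binary.PropositionalEquality

open Equivalence using (to; from)

private
  variable
    A : Set
    m n : ℕ
    u w x y : Fin n
    e f p q E : Subset n

∈-tabulate⇔ : ∀ {f : Fin n → Bool} {i} → i ∈ tabulate f ⇔ T (f i)
∈-tabulate⇔ {f = f} {i} = mk⇔
  (λ i∈ → from T-≡ (trans (sym (lookup∘tabulate f i)) ([]=⇒lookup i∈)))
  (λ t → lookup⇒[]= i (tabulate f) (trans (lookup∘tabulate f i) (to T-≡ t)))

x∈p─q⇒x∉q : ∀ (p q : Subset n) → x ∈ p ─ q → x ∉ q
x∈p─q⇒x∉q (_ ∷ p) (inside  ∷ q) ()        here
x∈p─q⇒x∉q (_ ∷ p) (outside ∷ q) here      ()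
x∈p─q⇒x∉q (_ ∷ p) (_       ∷ q) (there m) (there m′) = x∈p─q⇒x∉q p q m m′

x∈p-y⇒x≢y : ∀ (p : Subset n) → x ∈ p - y → x ≢ y
x∈p-y⇒x≢y {y = y} p x∈ refl = x∈p─q⇒x∉q p ⁅ y ⁆ x∈ (x∈⁅x⁆ y)

x∈p-y⇒x∈p : ∀ (p : Subset n) → x ∈ p - y → x ∈ p
x∈p-y⇒x∈p {y = y} p = p─q⊆p p ⁅ y ⁆

x∈p⇒suc∣p-x∣≡∣p∣ : ∀ (p : Subset n) → x ∈ p → suc ∣ p - x ∣ ≡ ∣ p ∣
x∈p⇒suc∣p-x∣≡∣p∣ (inside  ∷ p) here      = cong (suc ∘ ∣_∣) (p─⊥≡p p)
x∈p⇒suc∣p-x∣≡∣p∣ (inside  ∷ p) (there m) = cong suc (x∈p⇒suc∣p-x∣≡∣p∣ p m)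
x∈p⇒suc∣p-x∣≡∣p∣ (outside ∷ p) (there m) = x∈p⇒suc∣p-x∣≡∣p∣ p m

x∈p⇒p∪⁅x⁆≡p : x ∈ p → p ∪ ⁅ x ⁆ ≡ p
x∈p⇒p∪⁅x⁆≡p {x = x} {p = p} x∈p = ⊆-antisym
  (λ z∈ → [ (λ z∈p → z∈p) , (λ z∈x → subst (_∈ p) (sym (x∈⁅y⁆⇒x≡y x z∈x)) x∈p) ]′ (x∈p∪q⁻ p ⁅ x ⁆ z∈))
  (p⊆p∪q ⁅ x ⁆)

x∈p⇒p-x∪⁅x⁆≡p : x ∈ p → (p - x) ∪ ⁅ x ⁆ ≡ p
x∈p⇒p-x∪⁅x⁆≡p {x = x} {p = p} x∈p = ⊆-antisym
  (λ z∈ → [ x∈p-y⇒x∈p p , (λ z∈x → subst (_∈ p) (sym (x∈⁅y⁆⇒x≡y x z∈x)) x∈p) ]′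
            (x∈p∪q⁻ (p - x) ⁅ x ⁆ z∈))
  (λ z∈p → x∈p∪q⁺ (split z∈p))
  where
  split : ∀ {z} → z ∈ p → z ∈ p - x ⊎ z ∈ ⁅ x ⁆
  split {z} z∈p with z ≟ x
  ... | yes refl = inj₂ (x∈⁅x⁆ x)
  ... | no z≢x   = inj₁ (x∈p∧x≢y⇒x∈p-y z∈p z≢x)

x∉p⇒p∪⁅x⁆-x≡p : x ∉ p → (p ∪ ⁅ x ⁆) - x ≡ p
x∉p⇒p∪⁅x⁆-x≡p {x = x} {p = p} x∉p = ⊆-antisym
  (λ z∈ → [ (λ z∈p → z∈p) , (λ z∈x → contradiction (x∈⁅y⁆⇒x≡y x z∈x) (x∈p-y⇒x≢y (p ∪ ⁅ x ⁆) z∈)) ]′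
            (x∈p∪q⁻ p ⁅ x ⁆ (x∈p-y⇒x∈p (p ∪ ⁅ x ⁆) z∈)))
  (λ z∈p → x∈p∧x≢y⇒x∈p-y (x∈p∪q⁺ (inj₁ z∈p)) λ { refl → x∉p z∈p })

∣q∣<∣p∣⇒∃∈p∉q : ∣ q ∣ < ∣ p ∣ → ∃ λ y → y ∈ p × y ∉ q
∣q∣<∣p∣⇒∃∈p∉q {q = q} {p = p} ∣q∣<∣p∣ with nonempty? (p ─ q)
... | yes (y , y∈) = y , p─q⊆p p q y∈ , x∈p─q⇒x∉q p q y∈
... | no  p─q≡∅    = contradiction (p⊆q⇒∣p∣≤∣q∣ p⊆q) (ℕ.<⇒≱ ∣q∣<∣p∣)
  where
  p⊆q : p ⊆ q
  p⊆q {z} z∈p with z ∈? q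
  ... | yes z∈q = z∈q
  ... | no  z∉q = contradiction (z , x∈p∧x∉q⇒x∈p─q z∈p z∉q) p─q≡∅

∣[p-x∪⁅y⁆]∩q∣<∣p∩q∣ : x ∈ p ∩ q → y ∉ q → ∣ ((p - x) ∪ ⁅ y ⁆) ∩ q ∣ < ∣ p ∩ q ∣
∣[p-x∪⁅y⁆]∩q∣<∣p∩q∣ {x = x} {p = p} {q = q} {y = y} x∈p∩q y∉q =
  ℕ.≤-<-trans (p⊆q⇒∣p∣≤∣q∣ ⊆[p∩q]-x) (x∈p⇒∣p-x∣<∣p∣ x∈p∩q)
  where
  ⊆[p∩q]-x : ((p - x) ∪ ⁅ y ⁆) ∩ q ⊆ (p ∩ q) - x
  ⊆[p∩q]-x z∈ with x∈p∩q⁻ _ q z∈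
  ... | z∈p-x∪y , z∈q with x∈p∪q⁻ (p - x) ⁅ y ⁆ z∈p-x∪y
  ...   | inj₁ z∈p-x = x∈p∧x≢y⇒x∈p-y (x∈p∩q⁺ (x∈p-y⇒x∈p p z∈p-x , z∈q)) (x∈p-y⇒x≢y p z∈p-x)
  ...   | inj₂ z∈y   = contradiction (subst (_∈ q) (x∈⁅y⁆⇒x≡y y z∈y) z∈q) y∉q

T-anyFin⇔ : ∀ {f : Fin m → Bool} → T (anyFin f) ⇔ ∃ λ i → T (f i)
T-anyFin⇔ {zero}  = mk⇔ (λ ()) (λ ())
T-anyFin⇔ {suc m} {f} = mk⇔
  (λ t → [ (λ t₀ → zero , t₀) , (λ t′ → let (i , tᵢ) = to T-anyFin⇔ t′ in suc i , tᵢ) ]′ (to T-∨ t))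
  (λ { (zero , t₀) → from T-∨ (inj₁ t₀) ; (suc i , tᵢ) → from T-∨ (inj₂ (from T-anyFin⇔ (i , tᵢ))) })

T-does-≟⇔ : ∀ {x y : Fin n} → T (does (x ≟ y)) ⇔ x ≡ y
T-does-≟⇔ {x = x} {y} with x ≟ y
... | yes x≡y = mk⇔ (λ _ → x≡y) _
... | no  x≢y = mk⇔ (λ ()) x≢y

∈-image⇔ : ∀ {φ : Fin m → Fin n} {S v} → v ∈ image φ S ⇔ ∃ λ i → i ∈ S × φ i ≡ v
∈-image⇔ {φ = φ} {S} = mk⇔
  (λ v∈ → let (i , t) = to T-anyFin⇔ (to ∈-tabulate⇔ v∈) ; (i∈S , φi≡v) = to T-∧ t
          in i , lookup⇒[]= i S (to T-≡ i∈S) , to (T-does-≟⇔ {x = φ i}) φi≡v)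
  (λ (i , i∈S , φi≡v) → from ∈-tabulate⇔ (from T-anyFin⇔
     (i , from T-∧ (from T-≡ ([]=⇒lookup i∈S) , from T-does-≟⇔ φi≡v))))

image-≡ : ∀ {φ : Fin m → Fin n} {S X} → (∀ {i} → i ∈ S → φ i ∈ X)
        → (∀ {v} → v ∈ X → ∃ λ i → i ∈ S × φ i ≡ v) → image φ S ≡ X
image-≡ {φ = φ} {X = X} into onto = ⊆-antisym
  (λ v∈ → let (i , i∈S , φi≡v) = to (∈-image⇔ {φ = φ}) v∈ in subst (_∈ X) φi≡v (into i∈S))
  (λ v∈X → from (∈-image⇔ {φ = φ}) (onto v∈X))

∷-preserves-injective : ∀ {x : A} {f : Fin m → A} → Injective _≡_ _≡_ f → (∀ i → f i ≢ x)
            → Injective _≡_ _≡_ (x Vector.∷ f)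
∷-preserves-injective f-inj fᵢ≢x {zero}  {zero}  _    = refl
∷-preserves-injective f-inj fᵢ≢x {zero}  {suc j} x≡fⱼ = contradiction (sym x≡fⱼ) (fᵢ≢x j)
∷-preserves-injective f-inj fᵢ≢x {suc i} {zero}  fᵢ≡x = contradiction fᵢ≡x (fᵢ≢x i)
∷-preserves-injective f-inj fᵢ≢x {suc i} {suc j} fᵢ≡fⱼ = cong suc (f-inj fᵢ≡fⱼ)

[,]′-preserves-injective : ∀ {B C : Set} {f : B → A} {g : C → A}
                         → Injective _≡_ _≡_ f → Injective _≡_ _≡_ g
                         → (∀ b c → f b ≢ g c) → Injective _≡_ _≡_ [ f , g ]′
[,]′-preserves-injective f-inj g-inj f≢g {inj₁ b} {inj₁ b′} fb≡fb′ = cong inj₁ (f-inj fb≡fb′)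
[,]′-preserves-injective f-inj g-inj f≢g {inj₁ b} {inj₂ c}  fb≡gc  = contradiction fb≡gc (f≢g b c)
[,]′-preserves-injective f-inj g-inj f≢g {inj₂ c} {inj₁ b}  gc≡fb  = contradiction (sym gc≡fb) (f≢g b c)
[,]′-preserves-injective f-inj g-inj f≢g {inj₂ c} {inj₂ c′} gc≡gc′ = cong inj₂ (g-inj gc≡gc′)

splitAt-injective : ∀ m {n} → Injective _≡_ _≡_ (splitAt m {n})
splitAt-injective m {n} {i} {j} eq =
  trans (sym (Fin.join-splitAt m n i)) (trans (cong (join m n) eq) (Fin.join-splitAt m n j))

record Enumeration (p : Subset n) (m : ℕ) : Set where
  field
    at           : Fin m → Fin n
    at-injective : Injective _≡_ _≡_ at
    at-∈         : ∀ i → at i ∈ p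
    at-onto      : ∀ {v} → v ∈ p → ∃ λ i → at i ≡ v

enumeration : (p : Subset n) → Enumeration p ∣ p ∣
enumeration [] = record { at = λ () ; at-injective = λ {} ; at-∈ = λ () ; at-onto = λ () }
enumeration (outside ∷ p) = record
  { at           = suc ∘ at
  ; at-injective = at-injective ∘ Fin.suc-injective
  ; at-∈         = there ∘ at-∈
  ; at-onto      = λ { (there v∈p) → let (i , atᵢ≡v) = at-onto v∈p in i , cong suc atᵢ≡v } }
  where open Enumeration (enumeration p)
enumeration (inside ∷ p) = record
  { at           = zero Vector.∷ suc ∘ at
  ; at-injective = ∷-preserves-injective (at-injective ∘ Fin.suc-injective) (λ _ ())
  ; at-∈         = λ { zero → here ; (suc i) → there (at-∈ i) }
  ; at-onto      = λ { here → zero , refl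
                     ; (there v∈p) → let (i , atᵢ≡v) = at-onto v∈p in suc i , cong suc atᵢ≡v } }
  where
  open Enumeration (enumeration p)

∈tEdge₁⇔ : ∀ {r} {i : Fin (tVerts r)} → i ∈ tEdge₁ r ⇔ toℕ i < r
∈tEdge₁⇔ {r} {i} = mk⇔ (ℕ.<ᵇ⇒< (toℕ i) r ∘ to ∈-tabulate⇔) (from ∈-tabulate⇔ ∘ ℕ.<⇒<ᵇ)

∈tEdge₂⇔ : ∀ {r} {i : Fin (tVerts r)} → i ∈ tEdge₂ r ⇔ (toℕ i < r ∸ 1 ⊎ toℕ i ≡ r)
∈tEdge₂⇔ {r} {i} = mk⇔
  (λ i∈ → Sum.map (ℕ.<ᵇ⇒< (toℕ i) (r ∸ 1)) (ℕ.≡ᵇ⇒≡ (toℕ i) r) (to T-∨ (to ∈-tabulate⇔ i∈)))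
  (λ lt⊎eq → from ∈-tabulate⇔ (from T-∨ (Sum.map ℕ.<⇒<ᵇ (ℕ.≡⇒≡ᵇ (toℕ i) r) lt⊎eq)))

∈tEdge₃⇔ : ∀ {r} {i : Fin (tVerts r)} → i ∈ tEdge₃ r ⇔ r ∸ 1 ≤ toℕ i
∈tEdge₃⇔ {r} {i} = mk⇔ (ℕ.≤ᵇ⇒≤ (r ∸ 1) (toℕ i) ∘ to ∈-tabulate⇔) (from ∈-tabulate⇔ ∘ ℕ.≤⇒≤ᵇ)

-- In the labelling {1,…,2r-1} of T_r, r = s + 2: core = {1,…,r-1}, left = r, right = r+1 and
-- petal = {r+2,…,2r-1}.
data TVertex (s : ℕ) : Fin (tVerts (suc (suc s))) → Set where
  core  : (k : Fin (suc s)) → TVertex s (k ↑ˡ suc (suc s))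
  left  : TVertex s (suc s ↑ʳ zero)
  right : TVertex s (suc s ↑ʳ suc zero)
  petal : (d : Fin s) → TVertex s (suc s ↑ʳ suc (suc d))

tVertex : ∀ {s} i → TVertex s i
tVertex {s} i with splitAt (suc s) i in eq
... | inj₁ k               = subst (TVertex s) (Fin.splitAt⁻¹-↑ˡ eq) (core k)
... | inj₂ zero            = subst (TVertex s) (Fin.splitAt⁻¹-↑ʳ eq) left
... | inj₂ (suc zero)      = subst (TVertex s) (Fin.splitAt⁻¹-↑ʳ eq) right
... | inj₂ (suc (suc d))   = subst (TVertex s) (Fin.splitAt⁻¹-↑ʳ eq) (petal d)

module _ {s : ℕ} where

  private
    r : ℕ
    r = suc (suc s)

    toℕ-core : (k : Fin (suc s)) → toℕ (k ↑ˡ r) < suc s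
    toℕ-core k = subst (_< suc s) (sym (Fin.toℕ-↑ˡ k r)) (Fin.toℕ<n k)

    toℕ-tail : (j : Fin r) → toℕ (suc s ↑ʳ j) ≡ toℕ j + suc s
    toℕ-tail j = trans (Fin.toℕ-↑ʳ (suc s) j) (ℕ.+-comm (suc s) (toℕ j))

    r<toℕ-petal : (d : Fin s) → r < toℕ (suc s ↑ʳ suc (suc d))
    r<toℕ-petal d = subst (r <_) (sym (toℕ-tail (suc (suc d)))) (s≤s (s≤s (ℕ.m≤n+m (suc s) (toℕ d))))

  core∈ : ∀ k → k ↑ˡ r ∈ tEdge₁ r × k ↑ˡ r ∈ tEdge₂ r × k ↑ˡ r ∉ tEdge₃ r
  core∈ k = from (∈tEdge₁⇔ {r}) (ℕ.m<n⇒m<1+n (toℕ-core k))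
          , from (∈tEdge₂⇔ {r}) (inj₁ (toℕ-core k))
          , ℕ.<⇒≱ (toℕ-core k) ∘ to (∈tEdge₃⇔ {r})

  left∈ : suc s ↑ʳ zero ∈ tEdge₁ r × suc s ↑ʳ zero ∉ tEdge₂ r × suc s ↑ʳ zero ∈ tEdge₃ r
  left∈ = from (∈tEdge₁⇔ {r}) (subst (_< r) (sym (toℕ-tail zero)) (ℕ.n<1+n (suc s)))
        , [ ℕ.<-irrefl (toℕ-tail zero) , (λ t≡r → ℕ.1+n≢n (sym (trans (sym (toℕ-tail zero)) t≡r))) ]′
          ∘ to (∈tEdge₂⇔ {r})
        , from (∈tEdge₃⇔ {r}) (ℕ.≤-reflexive (sym (toℕ-tail zero)))

  right∈ : suc s ↑ʳ suc zero ∉ tEdge₁ r × suc s ↑ʳ suc zero ∈ tEdge₂ r × suc s ↑ʳ suc zero ∈ tEdge₃ r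
  right∈ = ℕ.<-irrefl (toℕ-tail (suc zero)) ∘ to (∈tEdge₁⇔ {r})
         , from (∈tEdge₂⇔ {r}) (inj₂ (toℕ-tail (suc zero)))
         , from (∈tEdge₃⇔ {r}) (subst (suc s ≤_) (sym (toℕ-tail (suc zero))) (ℕ.n≤1+n (suc s)))

  petal∈ : ∀ d → suc s ↑ʳ suc (suc d) ∉ tEdge₁ r × suc s ↑ʳ suc (suc d) ∉ tEdge₂ r
                × suc s ↑ʳ suc (suc d) ∈ tEdge₃ r
  petal∈ d = ℕ.<-asym (r<toℕ-petal d) ∘ to (∈tEdge₁⇔ {r})
           , [ ℕ.<-asym (ℕ.<-trans (ℕ.n<1+n (suc s)) (r<toℕ-petal d)) , ℕ.>⇒≢ (r<toℕ-petal d) ]′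
             ∘ to (∈tEdge₂⇔ {r})
           , from (∈tEdge₃⇔ {r}) (ℕ.<⇒≤ (ℕ.<-trans (ℕ.n<1+n (suc s)) (r<toℕ-petal d)))

module _ {n s} {H : Hypergraph n} {K D : Subset n} {u w : Fin n}
  (∣K∣≡1+s : ∣ K ∣ ≡ suc s) (∣D∣≡s : ∣ D ∣ ≡ s) (u≢w : u ≢ w) (u∉K : u ∉ K) (w∉K : w ∉ K)
  (u∉D : u ∉ D) (w∉D : w ∉ D) (D∩K≡∅ : ∀ {v} → v ∈ D → v ∉ K) where

  private
    r : ℕ
    r = suc (suc s)

    module K = Enumeration (subst (Enumeration K) ∣K∣≡1+s (enumeration K))
    module D = Enumeration (subst (Enumeration D) ∣D∣≡s (enumeration D))

    φʳ : Fin r → Fin n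
    φʳ = u Vector.∷ w Vector.∷ D.at

    φ : Fin (tVerts r) → Fin n
    φ = [ K.at , φʳ ]′ ∘ splitAt (suc s)

    φ-core : ∀ k → φ (k ↑ˡ r) ≡ K.at k
    φ-core k = cong [ K.at , φʳ ]′ (Fin.splitAt-↑ˡ (suc s) k r)

    φ-tail : ∀ j → φ (suc s ↑ʳ j) ≡ φʳ j
    φ-tail j = cong [ K.at , φʳ ]′ (Fin.splitAt-↑ʳ (suc s) r j)

    φʳ∉K : ∀ j → φʳ j ∉ K
    φʳ∉K zero          = u∉K
    φʳ∉K (suc zero)    = w∉K
    φʳ∉K (suc (suc d)) = D∩K≡∅ (D.at-∈ d)

    φ-injective : Injective _≡_ _≡_ φ
    φ-injective = splitAt-injective (suc s) ∘ [,]′-preserves-injective K.at-injective φʳ-injective K∌φʳ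
      where
      φʳ-injective : Injective _≡_ _≡_ φʳ
      φʳ-injective = ∷-preserves-injective
        (∷-preserves-injective D.at-injective λ d Dd≡w → w∉D (subst (_∈ D) Dd≡w (D.at-∈ d)))
        λ { zero w≡u → u≢w (sym w≡u) ; (suc d) Dd≡u → u∉D (subst (_∈ D) Dd≡u (D.at-∈ d)) }
      K∌φʳ : ∀ k j → K.at k ≢ φʳ j
      K∌φʳ k j Kk≡φʳj = φʳ∉K j (subst (_∈ K) Kk≡φʳj (K.at-∈ k))

    hit-core : ∀ {S v} → (∀ k → k ↑ˡ r ∈ S) → v ∈ K → ∃ λ i → i ∈ S × φ i ≡ v
    hit-core core∈S v∈K = let (k , Kk≡v) = K.at-onto v∈K in k ↑ˡ r , core∈S k , trans (φ-core k) Kk≡v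

    hit-tail : ∀ {S v} j → suc s ↑ʳ j ∈ S → v ∈ ⁅ φʳ j ⁆ → ∃ λ i → i ∈ S × φ i ≡ v
    hit-tail j j∈S v∈ = suc s ↑ʳ j , j∈S , trans (φ-tail j) (sym (x∈⁅y⁆⇒x≡y _ v∈))

    hit-petal : ∀ {S v} → (∀ d → suc s ↑ʳ suc (suc d) ∈ S) → v ∈ D → ∃ λ i → i ∈ S × φ i ≡ v
    hit-petal petal∈S v∈D = let (d , Dd≡v) = D.at-onto v∈D in
      suc s ↑ʳ suc (suc d) , petal∈S d , trans (φ-tail (suc (suc d))) Dd≡v

    image₁ : image φ (tEdge₁ r) ≡ K ∪ ⁅ u ⁆
    image₁ = image-≡ (λ i∈ → into (tVertex _) i∈) onto
      where
      into : ∀ {i} → TVertex s i → i ∈ tEdge₁ r → φ i ∈ K ∪ ⁅ u ⁆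
      into (core k)  _  = subst (_∈ K ∪ ⁅ u ⁆) (sym (φ-core k)) (x∈p∪q⁺ (inj₁ (K.at-∈ k)))
      into left      _  = subst (_∈ K ∪ ⁅ u ⁆) (sym (φ-tail zero)) (x∈p∪q⁺ (inj₂ (x∈⁅x⁆ u)))
      into right     i∈ = contradiction i∈ (proj₁ right∈)
      into (petal d) i∈ = contradiction i∈ (proj₁ (petal∈ d))
      onto : ∀ {v} → v ∈ K ∪ ⁅ u ⁆ → ∃ λ i → i ∈ tEdge₁ r × φ i ≡ v
      onto v∈ = [ hit-core (proj₁ ∘ core∈) , hit-tail zero (proj₁ left∈) ]′ (x∈p∪q⁻ K ⁅ u ⁆ v∈)

    image₂ : image φ (tEdge₂ r) ≡ K ∪ ⁅ w ⁆
    image₂ = image-≡ (λ i∈ → into (tVertex _) i∈) onto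
      where
      into : ∀ {i} → TVertex s i → i ∈ tEdge₂ r → φ i ∈ K ∪ ⁅ w ⁆
      into (core k)  _  = subst (_∈ K ∪ ⁅ w ⁆) (sym (φ-core k)) (x∈p∪q⁺ (inj₁ (K.at-∈ k)))
      into left      i∈ = contradiction i∈ (proj₁ (proj₂ left∈))
      into right     _  = subst (_∈ K ∪ ⁅ w ⁆) (sym (φ-tail (suc zero))) (x∈p∪q⁺ (inj₂ (x∈⁅x⁆ w)))
      into (petal d) i∈ = contradiction i∈ (proj₁ (proj₂ (petal∈ d)))
      onto : ∀ {v} → v ∈ K ∪ ⁅ w ⁆ → ∃ λ i → i ∈ tEdge₂ r × φ i ≡ v
      onto v∈ = [ hit-core (proj₁ ∘ proj₂ ∘ core∈) , hit-tail (suc zero) (proj₁ (proj₂ right∈)) ]′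
                  (x∈p∪q⁻ K ⁅ w ⁆ v∈)

    image₃ : image φ (tEdge₃ r) ≡ (D ∪ ⁅ w ⁆) ∪ ⁅ u ⁆
    image₃ = image-≡ (λ i∈ → into (tVertex _) i∈) onto
      where
      into : ∀ {i} → TVertex s i → i ∈ tEdge₃ r → φ i ∈ (D ∪ ⁅ w ⁆) ∪ ⁅ u ⁆
      into (core k)  i∈ = contradiction i∈ (proj₂ (proj₂ (core∈ k)))
      into left      _  = subst (_∈ (D ∪ ⁅ w ⁆) ∪ ⁅ u ⁆) (sym (φ-tail zero)) (x∈p∪q⁺ (inj₂ (x∈⁅x⁆ u)))
      into right     _  = subst (_∈ (D ∪ ⁅ w ⁆) ∪ ⁅ u ⁆) (sym (φ-tail (suc zero)))
                            (x∈p∪q⁺ (inj₁ (x∈p∪q⁺ (inj₂ (x∈⁅x⁆ w)))))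
      into (petal d) _  = subst (_∈ (D ∪ ⁅ w ⁆) ∪ ⁅ u ⁆) (sym (φ-tail (suc (suc d))))
                            (x∈p∪q⁺ (inj₁ (x∈p∪q⁺ (inj₁ (D.at-∈ d)))))
      onto : ∀ {v} → v ∈ (D ∪ ⁅ w ⁆) ∪ ⁅ u ⁆ → ∃ λ i → i ∈ tEdge₃ r × φ i ≡ v
      onto v∈ = [ [ hit-petal (proj₂ ∘ proj₂ ∘ petal∈) , hit-tail (suc zero) (proj₂ (proj₂ right∈)) ]′
                    ∘ x∈p∪q⁻ D ⁅ w ⁆
                , hit-tail zero (proj₂ (proj₂ left∈)) ]′ (x∈p∪q⁻ (D ∪ ⁅ w ⁆) ⁅ u ⁆ v∈)

  copyOfT : IsEdge H (K ∪ ⁅ u ⁆) → IsEdge H (K ∪ ⁅ w ⁆) → IsEdge H ((D ∪ ⁅ w ⁆) ∪ ⁅ u ⁆)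
          → CopyOfT (suc (suc s)) H
  copyOfT e₁ e₂ e₃ = φ , φ-injective
                   , subst (IsEdge H) (sym image₁) e₁
                   , subst (IsEdge H) (sym image₂) e₂
                   , subst (IsEdge H) (sym image₃) e₃

∈nbrSet⇔ : ∀ {H : Hypergraph n} → w ∈ nbrSet H f ⇔ IsEdge H (f ∪ ⁅ w ⁆)
∈nbrSet⇔ = ∈-tabulate⇔

module _ {k} {H : Hypergraph n} (uniform : Uniform (suc k) H) where

  ∣E-x∣≡k : IsEdge H E → x ∈ E → ∣ E - x ∣ ≡ k
  ∣E-x∣≡k {E = E} E∈H x∈E = ℕ.suc-injective (trans (x∈p⇒suc∣p-x∣≡∣p∣ E x∈E) (uniform E E∈H))

  E-x∈∂H : IsEdge H E → x ∈ E → InShadow (suc k) H (E - x)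
  E-x∈∂H {E = E} {x = x} E∈H x∈E = ∣E-x∣≡k E∈H x∈E , E , E∈H , p─q⊆p E ⁅ x ⁆

  w∈N[f]⇒w∉f : ∣ f ∣ ≡ k → w ∈ nbrSet H f → w ∉ f
  w∈N[f]⇒w∉f {f = f} ∣f∣≡k w∈N w∈f = ℕ.1+n≢n
    (trans (sym (uniform f (subst (IsEdge H) (x∈p⇒p∪⁅x⁆≡p w∈f) (to (∈nbrSet⇔ {H = H}) w∈N)))) ∣f∣≡k)

  exchange : ∀ {m} → MinPosCodegreeAtLeast (suc k) H m → ∣ q ∣ < m → IsEdge H E → x ∈ E
           → ∃ λ y → y ∉ q × IsEdge H ((E - x) ∪ ⁅ y ⁆)
  exchange {E = E} {x = x} codegree ∣q∣<m E∈H x∈E =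
    let (y , y∈N , y∉q) = ∣q∣<∣p∣⇒∃∈p∉q (ℕ.<-≤-trans ∣q∣<m (codegree (E - x) (E-x∈∂H E∈H x∈E)))
    in y , y∉q , to (∈nbrSet⇔ {H = H}) y∈N

module _ {s} {H : Hypergraph n} (uniform : Uniform (suc (suc s)) H) where

  E∩[e-u]≡∅⇒CopyOfT : IsEdge H e → u ∈ e → w ∈ nbrSet H (e - u) → w ≢ u
                     → IsEdge H E → u ∈ E → w ∈ E → Empty (E ∩ (e - u)) → CopyOfT (suc (suc s)) H
  E∩[e-u]≡∅⇒CopyOfT {e = e} {u = u} {w = w} {E = E} e∈H u∈e w∈N w≢u E∈H u∈E w∈E E∩[e-u]≡∅ =
    copyOfT {H = H} ∣e-u∣≡ ∣D∣≡ (w≢u ∘ sym) u∉e-u w∉e-u u∉D w∉D D∩[e-u]≡∅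
      (subst (IsEdge H) (sym (x∈p⇒p-x∪⁅x⁆≡p u∈e)) e∈H)
      (to (∈nbrSet⇔ {H = H}) w∈N)
      (subst (IsEdge H) E≡D∪w∪u E∈H)
    where
    D = E - u - w
    ∣e-u∣≡ : ∣ e - u ∣ ≡ suc s
    ∣e-u∣≡ = ∣E-x∣≡k uniform e∈H u∈e
    w∈E-u : w ∈ E - u
    w∈E-u = x∈p∧x≢y⇒x∈p-y w∈E w≢u
    ∣D∣≡ : ∣ D ∣ ≡ s
    ∣D∣≡ = ℕ.suc-injective (trans (x∈p⇒suc∣p-x∣≡∣p∣ (E - u) w∈E-u) (∣E-x∣≡k uniform E∈H u∈E))
    u∉e-u : u ∉ e - u
    u∉e-u u∈ = x∈p-y⇒x≢y e u∈ refl
    w∉e-u : w ∉ e - u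
    w∉e-u = w∈N[f]⇒w∉f uniform ∣e-u∣≡ w∈N
    u∉D : u ∉ D
    u∉D u∈ = x∈p-y⇒x≢y E (x∈p-y⇒x∈p (E - u) u∈) refl
    w∉D : w ∉ D
    w∉D w∈ = x∈p-y⇒x≢y (E - u) w∈ refl
    D∩[e-u]≡∅ : ∀ {v} → v ∈ D → v ∉ e - u
    D∩[e-u]≡∅ {v} v∈D v∈e-u = E∩[e-u]≡∅ (v , x∈p∩q⁺ (x∈p-y⇒x∈p E (x∈p-y⇒x∈p (E - u) v∈D) , v∈e-u))
    E≡D∪w∪u : E ≡ (D ∪ ⁅ w ⁆) ∪ ⁅ u ⁆
    E≡D∪w∪u = begin
      E                     ≡⟨ sym (x∈p⇒p-x∪⁅x⁆≡p u∈E) ⟩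
      (E - u) ∪ ⁅ u ⁆       ≡⟨ cong (_∪ ⁅ u ⁆) (sym (x∈p⇒p-x∪⁅x⁆≡p w∈E-u)) ⟩
      (D ∪ ⁅ w ⁆) ∪ ⁅ u ⁆   ∎
      where open ≡-Reasoning

  module _ (T-free : TFree (suc (suc s)) H)
           (codegree : MinPosCodegreeAtLeast (suc (suc s)) H (suc (suc s))) where

    no-common-edge : IsEdge H e → u ∈ e → w ∈ nbrSet H (e - u) → w ≢ u
                   → IsEdge H E → u ∈ E → w ∈ E → ⊥
    no-common-edge {e = e} {u = u} {w = w} {E = E} e∈H u∈e w∈N w≢u = go (<-wellFounded ∣ E ∩ (e - u) ∣)
      where
      ∣e-u∣≡ : ∣ e - u ∣ ≡ suc s
      ∣e-u∣≡ = ∣E-x∣≡k uniform e∈H u∈e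
      stays : ∀ {z E} → z ∉ e - u → z ∈ E → x ∈ e - u → z ∈ (E - x) ∪ ⁅ y ⁆
      stays z∉e-u z∈E x∈e-u = x∈p∪q⁺ (inj₁ (x∈p∧x≢y⇒x∈p-y z∈E λ { refl → z∉e-u x∈e-u }))
      go : ∀ {E} → Acc _<_ ∣ E ∩ (e - u) ∣ → IsEdge H E → u ∈ E → w ∈ E → ⊥
      go {E} (acc smaller) E∈H u∈E w∈E with nonempty? (E ∩ (e - u))
      ... | no  E∩[e-u]≡∅ = T-free (E∩[e-u]≡∅⇒CopyOfT e∈H u∈e w∈N w≢u E∈H u∈E w∈E E∩[e-u]≡∅)
      ... | yes (x , x∈E∩[e-u]) =
        let (x∈E , x∈e-u) = x∈p∩q⁻ E (e - u) x∈E∩[e-u]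
            (y , y∉e-u , E′∈H) = exchange uniform codegree (ℕ.≤-reflexive (cong suc ∣e-u∣≡)) E∈H x∈E
        in go (smaller (∣[p-x∪⁅y⁆]∩q∣<∣p∩q∣ x∈E∩[e-u] y∉e-u)) E′∈H
              (stays (λ u∈e-u → x∈p-y⇒x≢y e u∈e-u refl) u∈E x∈e-u)
              (stays (w∈N[f]⇒w∉f uniform ∣e-u∣≡ w∈N) w∈E x∈e-u)

    nbr∩vertexNbr≡∅ : IsEdge H e → u ∈ e → w ∈ nbrSet H (e - u) → VNbr H u w → ⊥
    nbr∩vertexNbr≡∅ e∈H u∈e w∈N (w≢u , E , E∈H , w∈E , u∈E) = no-common-edge e∈H u∈e w∈N w≢u E∈H u∈E w∈E

    nbrSets-disjoint : ∀ {u′} → IsEdge H e → u ∈ e → u′ ∈ e → u ≢ u′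
                     → w ∈ nbrSet H (e - u) → w ∈ nbrSet H (e - u′) → ⊥
    nbrSets-disjoint {e = e} {u = u} {w = w} {u′} e∈H u∈e u′∈e u≢u′ w∈N w∈N′ =
      no-common-edge e∈H u∈e w∈N w≢u (to (∈nbrSet⇔ {H = H}) w∈N′)
        (x∈p∪q⁺ (inj₁ u∈e-u′)) (x∈p∪q⁺ (inj₂ (x∈⁅x⁆ w)))
      where
      u∈e-u′ : u ∈ e - u′
      u∈e-u′ = x∈p∧x≢y⇒x∈p-y u∈e u≢u′
      w≢u : w ≢ u
      w≢u refl = w∈N[f]⇒w∉f uniform (∣E-x∣≡k uniform e∈H u′∈e) w∈N′ u∈e-u′

    nbrSet-independent : IsEdge H e → u ∈ e → Independent H (nbrSet H (e - u))
    nbrSet-independent {e = e} {u = u} e∈H u∈e E E∈H x y x∈N y∈N x∈E y∈E with x ≟ y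
    ... | yes x≡y = x≡y
    ... | no  x≢y = ⊥-elim (no-common-edge e′∈H (x∈p∪q⁺ (inj₂ (x∈⁅x⁆ x))) y∈N′ (x≢y ∘ sym) E∈H x∈E y∈E)
      where
      e′∈H : IsEdge H ((e - u) ∪ ⁅ x ⁆)
      e′∈H = to (∈nbrSet⇔ {H = H}) x∈N
      y∈N′ : y ∈ nbrSet H (((e - u) ∪ ⁅ x ⁆) - x)
      y∈N′ = subst (λ f → y ∈ nbrSet H f)
               (sym (x∉p⇒p∪⁅x⁆-x≡p (w∈N[f]⇒w∉f uniform (∣E-x∣≡k uniform e∈H u∈e) x∈N))) y∈N

lemma2p2 : (r n : ℕ) → 2 ≤ r → (H : Hypergraph n) → Uniform r H → TFree r H
    → MinPosCodegreeAtLeast r H r → (e : Subset n) → IsEdge H e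
    → ((u : Fin n) → u ∈ e → (w : Fin n) → w ∈ nbrSet H (e - u) → VNbr H u w → ⊥)
      × ((u u′ : Fin n) → u ∈ e → u′ ∈ e → u ≢ u′ → (w : Fin n)
          → w ∈ nbrSet H (e - u) → w ∈ nbrSet H (e - u′) → ⊥)
      × ((u : Fin n) → u ∈ e → Independent H (nbrSet H (e - u)))
lemma2p2 .(suc (suc s)) n (s≤s (s≤s {n = s} _)) H uniform T-free codegree e e∈H =
    (λ u u∈e w → nbr∩vertexNbr≡∅ uniform T-free codegree e∈H u∈e)
  , (λ u u′ u∈e u′∈e u≢u′ w → nbrSets-disjoint uniform T-free codegree e∈H u∈e u′∈e u≢u′)
  , (λ u u∈e → nbrSet-independent uniform T-free codegree e∈H u∈e)
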